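{- For every integer $n\ge1$, $$\frac{1}{2^n}\sum_{b=0}^{2^n-1}\frac{3^{M_{n-1}(b)}}{2^n}=1.$$
   Context: Let $T^1:\mathbb{N}\to\mathbb{N}$ be the Collatz function, $T^1(N)=N/2$ if $N$ is even and $T^1(N)=\frac{3N+1}{2}$ if $N$ is odd; in particular $T^1(0)=0$. Write $T^1_k$ for the $k$-th iterate of $T^1$, with $T^1_0$ the identity. For an integer $n\ge1$ and $b\in\{0,\dots,2^n-1\}$, let $M_{n-1}(b)$ be the number of odd integers among $b, T^1_1(b),\dots,T^1_{n-1}(b)$. In particular $M_{n-1}(0)=0$. -}

module Defs where

open import Data.Nat as ℕ using (ℕ; zero; suc; _^_)
open import Data.Nat.Properties using (m^n≢0)
open import Data.Bool using (Bool; true; false)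
open import Data.Integer using (+_)
open import Data.Rational using (ℚ; 0ℚ; _+_; _*_; _/_)

T¹ : ℕ → ℕ
T¹ n with n ℕ.% 2
... | zero  = n ℕ./ 2
... | suc _ = (3 ℕ.* n ℕ.+ 1) ℕ./ 2

T¹^ : ℕ → ℕ → ℕ
T¹^ zero    b = b
T¹^ (suc k) b = T¹ (T¹^ k b)

isOdd : ℕ → ℕ
isOdd m = m ℕ.% 2

M : ℕ → ℕ → ℕ
M zero    b = isOdd (T¹^ zero b)
M (suc k) b = M k b ℕ.+ isOdd (T¹^ (suc k) b)

sumℚ : ℕ → (ℕ → ℚ) → ℚ
sumℚ zero    f = 0ℚ
sumℚ (suc m) f = sumℚ m f + f m

inv2^ : ℕ → ℚ
inv2^ n = (+ 1 / (2 ^ n)) {{m^n≢0 2 n}}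

term : ℕ → ℕ → ℚ
term n b = (+ (3 ^ M (n ℕ.∸ 1) b) / (2 ^ n)) {{m^n≢0 2 n}}

-- Sum 3^{M_k} along an arithmetic progression s·c + a with odd step s. Its even-indexed terms all share the
-- parity of a and its odd-indexed terms have the other parity, and one Collatz step maps each half onto a
-- progression of half the length with odd step (s for the even half, 3s for the odd half, which also picks up
-- a factor 3). By induction on k the sum over 2^{k+1} terms is therefore (1 + 3)·4^k = 4^{k+1} = 2^{k+1}·2^{k+1},
-- whatever s and a; the theorem is the case s = 1, a = 0.
module Submission where

open import Defs
open import Data.Nat using (ℕ; zero; suc; _+_; _*_; _^_; _≥_; NonZero) renaming (_/_ to _/ℕ_)
open import Data.Nat.Properties
  using (*-zeroʳ; *-identityˡ; *-identityʳ; +-assoc; *-distribˡ-+; *-distribʳ-+; *-suc; *-comm; +-comm; +-identityʳ; m*n≢0; m^n≢0)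
open import Data.Nat.DivMod using (m*n%n≡0; [m+kn]%n≡m%n; m*n/n≡m)
open import Data.Nat.Tactic.RingSolver using (solve-∀)
open import Data.Integer as ℤ using (+_)
import Data.Integer.Properties as ℤ
import Data.Integer.Tactic.RingSolver as ℤ
open import Data.Rational as ℚ using (1ℚ; _/_; toℚᵘ)
open import Data.Rational.Properties using (0/n≡0; toℚᵘ-injective; toℚᵘ-fromℚᵘ; toℚᵘ-homo-+; toℚᵘ-homo-*)
import Data.Rational.Unnormalised as ℚᵘ
import Data.Rational.Unnormalised.Properties as ℚᵘ
open import Relation.Binary.PropositionalEquality using (_≡_; refl; sym; trans; cong; cong₂; subst; module ≡-Reasoning)

data EvenOdd : ℕ → Set where
  even : ∀ q → EvenOdd (2 * q)
  odd  : ∀ q → EvenOdd (2 * q + 1)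

evenOdd : ∀ a → EvenOdd a
evenOdd zero = even 0
evenOdd (suc a) with evenOdd a
... | even q = subst EvenOdd (+-comm (2 * q) 1) (odd q)
... | odd q  = subst EvenOdd (trans (*-suc 2 q) (cong suc (sym (+-comm (2 * q) 1)))) (even (suc q))

isOdd-even : ∀ q → isOdd (2 * q) ≡ 0
isOdd-even q = trans (cong isOdd (*-comm 2 q)) (m*n%n≡0 q 2)

isOdd-odd : ∀ q → isOdd (2 * q + 1) ≡ 1
isOdd-odd q = trans (cong isOdd (trans (+-comm (2 * q) 1) (cong suc (*-comm 2 q)))) ([m+kn]%n≡m%n 1 q 2)

T¹-even : ∀ q → T¹ (2 * q) ≡ q
T¹-even q rewrite isOdd-even q = trans (cong (_/ℕ 2) (*-comm 2 q)) (m*n/n≡m q 2)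

T¹-odd : ∀ q → T¹ (2 * q + 1) ≡ 3 * q + 2
T¹-odd q rewrite isOdd-odd q = trans (cong (_/ℕ 2) (3[2q+1]+1≡[3q+2]*2 q)) (m*n/n≡m (3 * q + 2) 2)
  where 3[2q+1]+1≡[3q+2]*2 : ∀ q → 3 * (2 * q + 1) + 1 ≡ (3 * q + 2) * 2
        3[2q+1]+1≡[3q+2]*2 = solve-∀

T¹^-T¹ : ∀ k b → T¹^ k (T¹ b) ≡ T¹^ (suc k) b
T¹^-T¹ zero    b = refl
T¹^-T¹ (suc k) b = cong T¹ (T¹^-T¹ k b)

M-suc : ∀ k b → M (suc k) b ≡ isOdd b + M k (T¹ b)
M-suc zero    b = refl
M-suc (suc k) b = begin
  M (suc k) b + isOdd (T¹^ (suc (suc k)) b)            ≡⟨ cong₂ _+_ (M-suc k b) (cong isOdd (sym (T¹^-T¹ (suc k) b))) ⟩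
  isOdd b + M k (T¹ b) + isOdd (T¹^ (suc k) (T¹ b))    ≡⟨ +-assoc (isOdd b) _ _ ⟩
  isOdd b + M (suc k) (T¹ b)                           ∎
  where open ≡-Reasoning

weight : ℕ → ℕ → ℕ
weight k b = 3 ^ M k b

weight-even : ∀ k q → weight (suc k) (2 * q) ≡ weight k q
weight-even k q = cong (3 ^_) (trans (M-suc k (2 * q)) (cong₂ _+_ (isOdd-even q) (cong (M k) (T¹-even q))))

weight-odd : ∀ k q → weight (suc k) (2 * q + 1) ≡ 3 * weight k (3 * q + 2)
weight-odd k q = cong (3 ^_) (trans (M-suc k (2 * q + 1)) (cong₂ _+_ (isOdd-odd q) (cong (M k) (T¹-odd q))))

sumℕ : ℕ → (ℕ → ℕ) → ℕ
sumℕ zero    f = 0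
sumℕ (suc m) f = sumℕ m f + f m

sumℕ-cong : ∀ m {f g : ℕ → ℕ} → (∀ b → f b ≡ g b) → sumℕ m f ≡ sumℕ m g
sumℕ-cong zero    f≗g = refl
sumℕ-cong (suc m) f≗g = cong₂ _+_ (sumℕ-cong m f≗g) (f≗g m)

sumℕ-*ˡ : ∀ m c (f : ℕ → ℕ) → sumℕ m (λ b → c * f b) ≡ c * sumℕ m f
sumℕ-*ˡ zero    c f = sym (*-zeroʳ c)
sumℕ-*ˡ (suc m) c f = trans (cong (_+ c * f m) (sumℕ-*ˡ m c f)) (sym (*-distribˡ-+ c (sumℕ m f) (f m)))

sumℕ-even+odd : ∀ m (f : ℕ → ℕ) →
  sumℕ (2 * m) f ≡ sumℕ m (λ d → f (2 * d)) + sumℕ m (λ d → f (2 * d + 1))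
sumℕ-even+odd zero    f = refl
sumℕ-even+odd (suc m) f = begin
  sumℕ (2 * suc m) f                                      ≡⟨ cong (λ n → sumℕ n f) (*-suc 2 m) ⟩
  sumℕ (2 * m) f + f (2 * m) + f (suc (2 * m))           ≡⟨ cong₂ (λ s t → s + f (2 * m) + f t) (sumℕ-even+odd m f) (+-comm 1 (2 * m)) ⟩
  E + O + f (2 * m) + f (2 * m + 1)                       ≡⟨ interchange E O (f (2 * m)) (f (2 * m + 1)) ⟩
  (E + f (2 * m)) + (O + f (2 * m + 1))                   ∎
  where
  open ≡-Reasoning
  E = sumℕ m (λ d → f (2 * d))
  O = sumℕ m (λ d → f (2 * d + 1))
  interchange : ∀ a b c d → a + b + c + d ≡ (a + c) + (b + d)
  interchange = solve-∀

3^isOdd+3^isOdd[2v+1+a]≡4 : ∀ v a → 3 ^ isOdd a + 3 ^ isOdd (2 * v + 1 + a) ≡ 4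
3^isOdd+3^isOdd[2v+1+a]≡4 v a with evenOdd a
... | even w = cong₂ (λ x y → 3 ^ x + 3 ^ y) (isOdd-even w) (trans (cong isOdd (shift v w)) (isOdd-odd (v + w)))
  where shift : ∀ v w → 2 * v + 1 + 2 * w ≡ 2 * (v + w) + 1
        shift = solve-∀
... | odd w  = cong₂ (λ x y → 3 ^ x + 3 ^ y) (isOdd-odd w) (trans (cong isOdd (shift v w)) (isOdd-even (v + w + 1)))
  where shift : ∀ v w → 2 * v + 1 + (2 * w + 1) ≡ 2 * (v + w + 1)
        shift = solve-∀

sum-weight-evenStep : ∀ k v a →
  sumℕ (2 ^ k) (λ d → weight k (2 * (2 * v + 1) * d + a)) ≡ 3 ^ isOdd a * 4 ^ k
sum-weight-oddStep : ∀ k v a →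
  sumℕ (2 ^ suc k) (λ c → weight k ((2 * v + 1) * c + a)) ≡ 4 ^ suc k

sum-weight-evenStep zero v a =
  trans (cong (λ b → 3 ^ isOdd (b + a)) (*-zeroʳ (2 * (2 * v + 1)))) (sym (*-identityʳ (3 ^ isOdd a)))
sum-weight-evenStep (suc k) v a with evenOdd a
... | even w = begin
  sumℕ (2 ^ suc k) (λ d → weight (suc k) (2 * (2 * v + 1) * d + 2 * w))  ≡⟨ sumℕ-cong (2 ^ suc k) halve ⟩
  sumℕ (2 ^ suc k) (λ d → weight k ((2 * v + 1) * d + w))               ≡⟨ sum-weight-oddStep k v w ⟩
  4 ^ suc k                                                             ≡⟨ *-identityˡ (4 ^ suc k) ⟨
  3 ^ 0 * 4 ^ suc k                                                     ≡⟨ cong (λ p → 3 ^ p * 4 ^ suc k) (isOdd-even w) ⟨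
  3 ^ isOdd (2 * w) * 4 ^ suc k                                         ∎
  where
  open ≡-Reasoning
  factor : ∀ v w d → 2 * (2 * v + 1) * d + 2 * w ≡ 2 * ((2 * v + 1) * d + w)
  factor = solve-∀
  halve : ∀ d → weight (suc k) (2 * (2 * v + 1) * d + 2 * w) ≡ weight k ((2 * v + 1) * d + w)
  halve d = trans (cong (weight (suc k)) (factor v w d)) (weight-even k _)
... | odd w = begin
  sumℕ (2 ^ suc k) (λ d → weight (suc k) (2 * (2 * v + 1) * d + (2 * w + 1)))    ≡⟨ sumℕ-cong (2 ^ suc k) triple ⟩
  sumℕ (2 ^ suc k) (λ d → 3 * weight k ((2 * (3 * v + 1) + 1) * d + (3 * w + 2))) ≡⟨ sumℕ-*ˡ (2 ^ suc k) 3 _ ⟩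
  3 * sumℕ (2 ^ suc k) (λ d → weight k ((2 * (3 * v + 1) + 1) * d + (3 * w + 2))) ≡⟨ cong (3 *_) (sum-weight-oddStep k (3 * v + 1) (3 * w + 2)) ⟩
  3 ^ 1 * 4 ^ suc k                                                              ≡⟨ cong (λ p → 3 ^ p * 4 ^ suc k) (isOdd-odd w) ⟨
  3 ^ isOdd (2 * w + 1) * 4 ^ suc k                                              ∎
  where
  open ≡-Reasoning
  factor : ∀ v w d → 2 * (2 * v + 1) * d + (2 * w + 1) ≡ 2 * ((2 * v + 1) * d + w) + 1
  factor = solve-∀
  regroup : ∀ v w d → 3 * ((2 * v + 1) * d + w) + 2 ≡ (2 * (3 * v + 1) + 1) * d + (3 * w + 2)
  regroup = solve-∀
  triple : ∀ d → weight (suc k) (2 * (2 * v + 1) * d + (2 * w + 1))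
               ≡ 3 * weight k ((2 * (3 * v + 1) + 1) * d + (3 * w + 2))
  triple d = trans (cong (weight (suc k)) (factor v w d))
                   (trans (weight-odd k ((2 * v + 1) * d + w)) (cong (λ b → 3 * weight k b) (regroup v w d)))

sum-weight-oddStep k v a = begin
  sumℕ (2 * 2 ^ k) (λ c → weight k (s * c + a))
    ≡⟨ sumℕ-even+odd (2 ^ k) _ ⟩
  sumℕ (2 ^ k) (λ d → weight k (s * (2 * d) + a)) + sumℕ (2 ^ k) (λ d → weight k (s * (2 * d + 1) + a))
    ≡⟨ cong₂ _+_ (sumℕ-cong (2 ^ k) (λ d → cong (weight k) (evenIndex v a d)))
                 (sumℕ-cong (2 ^ k) (λ d → cong (weight k) (oddIndex v a d))) ⟩
  sumℕ (2 ^ k) (λ d → weight k (2 * s * d + a)) + sumℕ (2 ^ k) (λ d → weight k (2 * s * d + (s + a)))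
    ≡⟨ cong₂ _+_ (sum-weight-evenStep k v a) (sum-weight-evenStep k v (s + a)) ⟩
  3 ^ isOdd a * 4 ^ k + 3 ^ isOdd (s + a) * 4 ^ k
    ≡⟨ *-distribʳ-+ (4 ^ k) (3 ^ isOdd a) _ ⟨
  (3 ^ isOdd a + 3 ^ isOdd (s + a)) * 4 ^ k
    ≡⟨ cong (_* 4 ^ k) (3^isOdd+3^isOdd[2v+1+a]≡4 v a) ⟩
  4 * 4 ^ k ∎
  where
  open ≡-Reasoning
  s = 2 * v + 1
  evenIndex : ∀ v a d → (2 * v + 1) * (2 * d) + a ≡ 2 * (2 * v + 1) * d + a
  evenIndex = solve-∀
  oddIndex : ∀ v a d → (2 * v + 1) * (2 * d + 1) + a ≡ 2 * (2 * v + 1) * d + (2 * v + 1 + a)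
  oddIndex = solve-∀

sum-weight : ∀ k → sumℕ (2 ^ suc k) (weight k) ≡ 4 ^ suc k
sum-weight k = trans (sumℕ-cong (2 ^ suc k) (λ c → cong (weight k) (1*c+0 c))) (sum-weight-oddStep k 0 0)
  where 1*c+0 : ∀ c → c ≡ 1 * c + 0
        1*c+0 c = sym (trans (+-identityʳ (1 * c)) (*-identityˡ c))

4^n≡2^n*2^n : ∀ n → 4 ^ n ≡ 2 ^ n * 2 ^ n
4^n≡2^n*2^n zero    = refl
4^n≡2^n*2^n (suc n) = trans (cong (4 *_) (4^n≡2^n*2^n n)) (regroup (2 ^ n))
  where regroup : ∀ x → 4 * (x * x) ≡ 2 * x * (2 * x)
        regroup = solve-∀

toℚᵘ-/ : ∀ i n .{{_ : NonZero n}} → toℚᵘ (i / n) ℚᵘ.≃ i ℚᵘ./ n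
toℚᵘ-/ i (suc n) = toℚᵘ-fromℚᵘ (ℚᵘ.mkℚᵘ i n)

/-distribʳ-+ : ∀ i j n .{{_ : NonZero n}} → (i ℤ.+ j) / n ≡ i / n ℚ.+ j / n
/-distribʳ-+ i j n@(suc _) = toℚᵘ-injective (begin
  toℚᵘ ((i ℤ.+ j) / n)                ≈⟨ toℚᵘ-/ (i ℤ.+ j) n ⟩
  (i ℤ.+ j) ℚᵘ./ n                    ≈⟨ ℚᵘ.*≡* (common-denominator i j (+ n)) ⟩
  i ℚᵘ./ n ℚᵘ.+ j ℚᵘ./ n              ≈⟨ ℚᵘ.+-cong (toℚᵘ-/ i n) (toℚᵘ-/ j n) ⟨
  toℚᵘ (i / n) ℚᵘ.+ toℚᵘ (j / n)      ≈⟨ toℚᵘ-homo-+ (i / n) (j / n) ⟨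
  toℚᵘ (i / n ℚ.+ j / n)              ∎)
  where
  open ℚᵘ.≃-Reasoning
  common-denominator : ∀ i j d → (i ℤ.+ j) ℤ.* (d ℤ.* d) ≡ (i ℤ.* d ℤ.+ j ℤ.* d) ℤ.* d
  common-denominator = ℤ.solve-∀

/-*-/ : ∀ i j m n .{{_ : NonZero m}} .{{_ : NonZero n}} →
        (i / m) ℚ.* (j / n) ≡ ((i ℤ.* j) / (m * n)) {{m*n≢0 m n}}
/-*-/ i j m@(suc _) n@(suc _) = toℚᵘ-injective (begin
  toℚᵘ (i / m ℚ.* (j / n))            ≈⟨ toℚᵘ-homo-* (i / m) (j / n) ⟩
  toℚᵘ (i / m) ℚᵘ.* toℚᵘ (j / n)      ≈⟨ ℚᵘ.*-cong (toℚᵘ-/ i m) (toℚᵘ-/ j n) ⟩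
  (i ℤ.* j) ℚᵘ./ (m * n)              ≈⟨ toℚᵘ-/ (i ℤ.* j) (m * n) ⟨
  toℚᵘ ((i ℤ.* j) / (m * n))          ∎)
  where open ℚᵘ.≃-Reasoning

n/n≡1 : ∀ n .{{_ : NonZero n}} → + n / n ≡ 1ℚ
n/n≡1 n@(suc _) = toℚᵘ-injective (ℚᵘ.≃-trans (toℚᵘ-/ (+ n) n) (ℚᵘ.*≡* (ℤ.*-comm (+ n) (+ 1))))

sumℚ-/ : ∀ d .{{_ : NonZero d}} m (f : ℕ → ℕ) → sumℚ m (λ b → + f b / d) ≡ + sumℕ m f / d
sumℚ-/ d zero    f = sym (0/n≡0 d)
sumℚ-/ d (suc m) f = begin
  sumℚ m (λ b → + f b / d) ℚ.+ + f m / d   ≡⟨ cong (ℚ._+ + f m / d) (sumℚ-/ d m f) ⟩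
  + sumℕ m f / d ℚ.+ + f m / d             ≡⟨ /-distribʳ-+ (+ sumℕ m f) (+ f m) d ⟨
  (+ sumℕ m f ℤ.+ + f m) / d               ≡⟨ cong (_/ d) (ℤ.pos-+ (sumℕ m f) (f m)) ⟨
  + (sumℕ m f + f m) / d                   ∎
  where open ≡-Reasoning

mainTheorem5 : (n : ℕ) → n ≥ 1 →
    inv2^ n ℚ.* sumℚ (2 ^ n) (term n) ≡ 1ℚ
mainTheorem5 (suc k) _ = begin
  + 1 / D ℚ.* sumℚ D (λ b → + weight k b / D)   ≡⟨ cong (+ 1 / D ℚ.*_) (sumℚ-/ D D (weight k)) ⟩
  + 1 / D ℚ.* (+ sumℕ D (weight k) / D)        ≡⟨ /-*-/ (+ 1) (+ sumℕ D (weight k)) D D ⟩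
  (+ 1 ℤ.* + sumℕ D (weight k)) / (D * D)       ≡⟨ cong (_/ (D * D)) (ℤ.*-identityˡ (+ sumℕ D (weight k))) ⟩
  + sumℕ D (weight k) / (D * D)                 ≡⟨ cong (λ s → + s / (D * D)) (trans (sum-weight k) (4^n≡2^n*2^n (suc k))) ⟩
  + (D * D) / (D * D)                           ≡⟨ n/n≡1 (D * D) ⟩
  1ℚ                                            ∎
  where
  open ≡-Reasoning
  D = 2 ^ suc k
  instance
    D≢0 : NonZero D
    D≢0 = m^n≢0 2 (suc k)
    D*D≢0 : NonZero (D * D)
    D*D≢0 = m*n≢0 D D
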